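{- For every finite poset $P$ and every $n$, $$Tr(n,P)\le \min\{m:\ \exists k\ (n,m)\rightarrow(k,Tr(k,P)+1)\}-1.$$
   Context: The sets $F_1,\dots,F_{|P|}$ form a copy of a poset $P$ if there is a bijection $i:P\to\{F_1,\dots,F_{|P|}\}$ such that $p<_P p'$ implies $i(p)\subsetneq i(p')$; a family is $P$-free if it contains no copy of $P$. For $X$ a set and $\mathcal F$ a family, $\mathcal F|_X=\{F\cap X:F\in\mathcal F\}$. A family $\mathcal F\subseteq 2^{[n]}$ is trace $P$-free if $\mathcal F|_L$ is $P$-free for every $L\subseteq[n]$, and $Tr(n,P)$ is the maximum size of a trace $P$-free family in $2^{[n]}$. The arrow relation $(n,m)\rightarrow(k,l)$ means: for every family $\mathcal F\subseteq 2^{[n]}$ with $|\mathcal F|=m$ there is a $k$-element set $X\subseteq[n]$ with $|\mathcal F|_X|\ge l$. -}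

module Defs where

open import Level using (0ℓ)
open import Data.Nat using (ℕ; suc; _<_; _≤_)
open import Data.Fin using (Fin)
open import Data.Fin.Subset using (Subset; _∩_; _⊂_; ∣_∣)
open import Data.List using (List; length; map)
open import Data.List.Membership.Propositional using (_∈_)
open import Data.List.Relation.Unary.All using (All)
open import Data.List.Relation.Unary.Unique.Propositional using (Unique)
open import Data.Product using (Σ; ∃; _×_)
open import Relation.Nullary using (¬_)
open import Relation.Binary.Core using (Rel)
open import Relation.Binary.PropositionalEquality using (_≡_)
open import Function.Definitions using (Injective)

record Family (n : ℕ) : Set where
  constructor family
  field
    sets   : List (Subset n)
    unique : Unique sets
open Family public

size : ∀ {n} → Family n → ℕ
size F = length (sets F)

-- A finite poset P = (Fin p, <P) with <P a strict partial order (w.r.t. ≡).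
CopyOf : ∀ {n p} → Rel (Fin p) 0ℓ → List (Subset n) → Set
CopyOf {n} {p} _<P_ G =
  Σ (Fin p → Subset n) λ i →
    Injective _≡_ _≡_ i
    × (∀ x → i x ∈ G)
    × (∀ x y → x <P y → i x ⊂ i y)

PFree : ∀ {n p} → Rel (Fin p) 0ℓ → List (Subset n) → Set
PFree _<P_ G = ¬ CopyOf _<P_ G

trace : ∀ {n} → List (Subset n) → Subset n → List (Subset n)
trace G X = map (_∩ X) G

TracePFree : ∀ {n p} → Rel (Fin p) 0ℓ → Family n → Set
TracePFree {n} _<P_ F = ∀ (L : Subset n) → PFree _<P_ (trace (sets F) L)

IsTr : ∀ {p} → ℕ → Rel (Fin p) 0ℓ → ℕ → Set
IsTr n _<P_ t =
  (Σ (Family n) λ F → TracePFree _<P_ F × size F ≡ t)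
  × (∀ (F : Family n) → TracePFree _<P_ F → size F ≤ t)

AtLeast : ∀ {n} → ℕ → List (Subset n) → Set
AtLeast {n} l G = Σ (List (Subset n)) λ L → Unique L × length L ≡ l × All (_∈ G) L

Arrow : ℕ → ℕ → ℕ → ℕ → Set
Arrow n m k l =
  ∀ (F : Family n) → size F ≡ m →
    Σ (Subset n) λ X → ∣ X ∣ ≡ k × AtLeast l (trace (sets F) X)

module Submission where

-- Suppose m ≤ Tr(n,P) and let F be an extremal trace P-free
-- family of size Tr(n,P).  Any m of its members form a family of size m,
-- so the arrow relation (n,m) → (k,Tr(k,P)+1) yields a k-set X on which
-- this subfamily has at least Tr(k,P)+1 distinct traces.  Reindexing X as
-- [k] turns these traces into a family on [k]; it is still trace P-free,
-- because a trace of it on L ⊆ [k] is, after re-embedding into [n], the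
-- trace of F on the image of L.  This contradicts the maximality of Tr(k,P).

open import Defs
open import Level using (0ℓ)
open import Data.Nat using (ℕ; suc; _<_)
open import Data.Fin using (Fin)
open import Relation.Binary.Core using (Rel)
open import Relation.Binary.Structures using (IsStrictPartialOrder)
open import Relation.Binary.PropositionalEquality using (_≡_)

open import Function using (_∘_; id)
open import Data.Nat using (_≤_; _≤?_)
open import Data.Nat.Properties using (≰⇒>; m≤n⇒m⊓n≡m; 1+n≰n)
open import Data.Bool using (true; false; _∧_)
open import Data.Bool.Properties using (∧-identityʳ; ∧-zeroʳ)
open import Data.Vec using ([]; _∷_; here)
open import Data.Fin.Subset using (Subset; _∩_; _⊆_; _⊂_; ∣_∣)
open import Data.Fin.Subset.Properties
  using (∩-assoc; ∩-idem; ⊆-refl; drop-∷-⊆; drop-∷-⊂; s⊆s; out⊆; s⊂s; out⊂; out⊂in; p⊂q⇒p⊆q)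
open import Data.List using (List; map; take)
open import Data.List.Properties using (length-take; length-map)
open import Data.List.Membership.Propositional using (_∈_)
open import Data.List.Membership.Propositional.Properties using (∈-map⁺; ∈-map⁻)
open import Data.List.Relation.Binary.Sublist.Propositional using (lookup)
import Data.List.Relation.Binary.Sublist.Setoid.Properties as SublistProps
import Data.List.Relation.Binary.Subset.Propositional.Properties as ListSubset
open import Data.List.Relation.Unary.All as All using (All; []; _∷_)
import Data.List.Relation.Unary.All.Properties as AllProps
open import Data.List.Relation.Unary.AllPairs using ([]; _∷_)
open import Data.List.Relation.Unary.Unique.Propositional using (Unique)
import Data.List.Relation.Unary.Unique.Propositional.Properties as UniqueProps
open import Data.Product using (Σ; _×_; _,_; proj₁)
open import Data.Empty using (⊥-elim)
open import Relation.Nullary using (yes; no; contradiction)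
open import Relation.Binary.PropositionalEquality
  using (refl; sym; trans; cong; cong₂; subst; setoid; module ≡-Reasoning)

-- compress X A : the restriction of A to the coordinates in X, reindexed
-- as a subset of [|X|].  expand X is its inverse on subsets of X.
compress : ∀ {n} (X : Subset n) → Subset n → Subset ∣ X ∣
compress []          []      = []
compress (true ∷ X)  (a ∷ A) = a ∷ compress X A
compress (false ∷ X) (_ ∷ A) = compress X A

expand : ∀ {n} (X : Subset n) → Subset ∣ X ∣ → Subset n
expand []          []      = []
expand (true ∷ X)  (b ∷ B) = b ∷ expand X B
expand (false ∷ X) B       = false ∷ expand X B

compress-expand : ∀ {n} (X : Subset n) B → compress X (expand X B) ≡ B
compress-expand []          []      = refl
compress-expand (true ∷ X)  (b ∷ B) = cong (b ∷_) (compress-expand X B)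
compress-expand (false ∷ X) B       = compress-expand X B

expand-injective : ∀ {n} (X : Subset n) {B C} → expand X B ≡ expand X C → B ≡ C
expand-injective X {B} {C} e = begin
  B                       ≡⟨ sym (compress-expand X B) ⟩
  compress X (expand X B) ≡⟨ cong (compress X) e ⟩
  compress X (expand X C) ≡⟨ compress-expand X C ⟩
  C                       ∎
  where open ≡-Reasoning

expand-compress : ∀ {n} (X : Subset n) A → expand X (compress X A) ≡ A ∩ X
expand-compress []          []      = refl
expand-compress (true ∷ X)  (a ∷ A) = cong₂ _∷_ (sym (∧-identityʳ a)) (expand-compress X A)
expand-compress (false ∷ X) (a ∷ A) = cong₂ _∷_ (sym (∧-zeroʳ a)) (expand-compress X A)

compress-∩ : ∀ {n} (X : Subset n) A → compress X (A ∩ X) ≡ compress X A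
compress-∩ []          []      = refl
compress-∩ (true ∷ X)  (a ∷ A) = cong₂ _∷_ (∧-identityʳ a) (compress-∩ X A)
compress-∩ (false ∷ X) (_ ∷ A) = compress-∩ X A

expand-compress-∩ : ∀ {n} (X : Subset n) A L →
  expand X (compress X A ∩ L) ≡ A ∩ expand X L
expand-compress-∩ []          []      []      = refl
expand-compress-∩ (true ∷ X)  (a ∷ A) (l ∷ L) = cong ((a ∧ l) ∷_) (expand-compress-∩ X A L)
expand-compress-∩ (false ∷ X) (a ∷ A) L       = cong₂ _∷_ (sym (∧-zeroʳ a)) (expand-compress-∩ X A L)

expand-⊆ : ∀ {n} (X : Subset n) {B C} → B ⊆ C → expand X B ⊆ expand X C
expand-⊆ []          {[]}        {[]}        _ = ⊆-refl
expand-⊆ (true ∷ X)  {false ∷ B} {c ∷ C}     h = out⊆ (expand-⊆ X (drop-∷-⊆ h))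
expand-⊆ (true ∷ X)  {true ∷ B}  {true ∷ C}  h = s⊆s (expand-⊆ X (drop-∷-⊆ h))
expand-⊆ (true ∷ X)  {true ∷ B}  {false ∷ C} h = contradiction (h here) λ ()
expand-⊆ (false ∷ X)                         h = s⊆s (expand-⊆ X h)

expand-⊂ : ∀ {n} (X : Subset n) {B C} → B ⊂ C → expand X B ⊂ expand X C
expand-⊂ []          {[]}        {[]}        (_ , () , _)
expand-⊂ (true ∷ X)  {false ∷ B} {false ∷ C} h = s⊂s (expand-⊂ X (drop-∷-⊂ h))
expand-⊂ (true ∷ X)  {true ∷ B}  {true ∷ C}  h = s⊂s (expand-⊂ X (drop-∷-⊂ h))
expand-⊂ (true ∷ X)  {false ∷ B} {true ∷ C}  h = out⊂in (expand-⊆ X (drop-∷-⊆ (p⊂q⇒p⊆q h)))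
expand-⊂ (true ∷ X)  {true ∷ B}  {false ∷ C} h = contradiction (proj₁ h here) λ ()
expand-⊂ (false ∷ X)                         h = out⊂ (expand-⊂ X h)

trace-∩ : ∀ {n} {G : List (Subset n)} {X A} → A ∈ trace G X → A ∩ X ≡ A
trace-∩ {X = X} A∈ with ∈-map⁻ (_∩ X) A∈
... | B , _ , refl = trans (∩-assoc B X X) (cong (B ∩_) (∩-idem X))

unique-map : ∀ {A B : Set} (P : A → Set) (f : A → B) →
  (∀ {a b} → P a → P b → f a ≡ f b → a ≡ b) →
  ∀ {xs} → All P xs → Unique xs → Unique (map f xs)
unique-map P f inj []         []          = []
unique-map P f inj (pa ∷ pxs) (a∉ ∷ uxs) =
  AllProps.map⁺ (All.zipWith (λ (pb , a≢b) → a≢b ∘ inj pa pb) (pxs , a∉))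
  ∷ unique-map P f inj pxs uxs

module _ {p} (_<P_ : Rel (Fin p) 0ℓ) where

  transport-copy : ∀ {a b} {G : List (Subset a)} {H : List (Subset b)}
    (f : Subset a → Subset b) →
    (∀ {B C} → f B ≡ f C → B ≡ C) → (∀ {B C} → B ⊂ C → f B ⊂ f C) →
    (∀ {B} → B ∈ G → f B ∈ H) → CopyOf _<P_ G → CopyOf _<P_ H
  transport-copy f f-inj f-⊂ f-∈ (i , i-inj , i-∈ , i-ord) =
    f ∘ i , i-inj ∘ f-inj , f-∈ ∘ i-∈ , λ x y x<y → f-⊂ (i-ord x y x<y)

  subfamily-trace-free : ∀ {n} (F F′ : Family n) →
    (∀ {A} → A ∈ sets F′ → A ∈ sets F) →
    TracePFree _<P_ F → TracePFree _<P_ F′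
  subfamily-trace-free F F′ F′⊆F F-free L =
    F-free L ∘ transport-copy id id id (ListSubset.map⁺ (_∩ L) F′⊆F)

  -- A list S of traces of F on X, reindexed as sets of [|X|], is still
  -- trace P-free: its trace on L re-embeds into the trace of F on expand X L.
  compressed-trace-free : ∀ {n} (F : Family n) (X : Subset n) {S} →
    All (_∈ trace (sets F) X) S → TracePFree _<P_ F →
    ∀ L → PFree _<P_ (trace (map (compress X) S) L)
  compressed-trace-free F X {S} S⊆F|X F-free L =
    F-free (expand X L) ∘ transport-copy (expand X) (expand-injective X) (expand-⊂ X) expand-∈
    where
    expand-∈ : ∀ {C} → C ∈ trace (map (compress X) S) L → expand X C ∈ trace (sets F) (expand X L)
    expand-∈ C∈ with ∈-map⁻ (_∩ L) C∈
    ... | D , D∈ , refl with ∈-map⁻ (compress X) D∈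
    ... | A , A∈S , refl with ∈-map⁻ (_∩ X) (All.lookup S⊆F|X A∈S)
    ... | B , B∈F , refl =
      subst (_∈ trace (sets F) (expand X L))
        (sym (trans (cong (λ E → expand X (E ∩ L)) (compress-∩ X B)) (expand-compress-∩ X B L)))
        (∈-map⁺ (_∩ expand X L) B∈F)

  restrict-family : ∀ {n} (F : Family n) (X : Subset n) {l} →
    TracePFree _<P_ F → AtLeast l (trace (sets F) X) →
    Σ (Family ∣ X ∣) λ G → TracePFree _<P_ G × size G ≡ l
  restrict-family F X F-free (S , S-unique , |S|≡l , S⊆F|X) =
    family (map (compress X) S) (unique-map (_∈ trace (sets F) X) (compress X) compress-inj S⊆F|X S-unique)
    , compressed-trace-free F X S⊆F|X F-free
    , trans (length-map (compress X) S) |S|≡l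
    where
    compress-inj : ∀ {A B} → A ∈ trace (sets F) X → B ∈ trace (sets F) X →
                   compress X A ≡ compress X B → A ≡ B
    compress-inj {A} {B} A∈ B∈ e = begin
      A                       ≡⟨ sym (trace-∩ A∈) ⟩
      A ∩ X                   ≡⟨ sym (expand-compress X A) ⟩
      expand X (compress X A) ≡⟨ cong (expand X) e ⟩
      expand X (compress X B) ≡⟨ expand-compress X B ⟩
      B ∩ X                   ≡⟨ trace-∩ B∈ ⟩
      B                       ∎
      where open ≡-Reasoning

prefix-family : ∀ {n} (F : Family n) m → m ≤ size F →
  Σ (Family n) λ F′ → size F′ ≡ m × (∀ {A} → A ∈ sets F′ → A ∈ sets F)
prefix-family {n} F m m≤|F| =
  family (take m (sets F)) (UniqueProps.take⁺ m (unique F))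
  , trans (length-take m (sets F)) (m≤n⇒m⊓n≡m m≤|F|)
  , lookup (SublistProps.take-⊆ (setoid (Subset n)) m (sets F))

proposition2p3 : (p : ℕ) (_<P_ : Rel (Fin p) 0ℓ) → IsStrictPartialOrder _≡_ _<P_ →
    (n : ℕ) (trn : ℕ) → IsTr n _<P_ trn →
    (m k trk : ℕ) → IsTr k _<P_ trk → Arrow n m k (suc trk) →
    trn < m
proposition2p3 p _<P_ _ n trn ((F , F-free , |F|≡trn) , _) m k trk (_ , Tr-k-max) arrow
  with m ≤? trn
... | no m≰trn = ≰⇒> m≰trn
... | yes m≤trn
  with prefix-family F m (subst (m ≤_) (sym |F|≡trn) m≤trn)
... | F′ , |F′|≡m , F′⊆F
  with arrow F′ |F′|≡m
... | X , refl , many-traces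
  with restrict-family _<P_ F′ X (subfamily-trace-free _<P_ F F′ F′⊆F F-free) many-traces
... | G , G-free , |G|≡1+trk =
  ⊥-elim (1+n≰n (subst (_≤ trk) |G|≡1+trk (Tr-k-max G G-free)))
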